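{- Let $\alpha\in\{+,-\}$, let $G$ be an almost strong $\alpha$-radial with root $r$, and let $x\in V(G)$. Then the bidirected graph obtained by adding to $G$ a new edge $e$ joining $x$ and $r$ is an almost strong $\alpha$-radial with root $r$ if the sign of $r$ over $e$ is $\alpha$.
   Context: A bidirected graph $G$ is a finite graph (loops and parallel edges allowed) with maps $\partial_+,\partial_-:E(G)\to 2^{V(G)}$ such that for each edge $e$ with (possibly identical) ends $u,v$: $\partial_\alpha(e)\subseteq\{u,v\}$, $\partial_+(e)\cup\partial_-(e)=\{u,v\}$, and $\partial_+(e)\cap\partial_-(e)=\emptyset$ if $e$ is not a loop. If $u\in\partial_\alpha(e)$, the sign of $u$ over $e$ is $\alpha$; $-\alpha$ denotes the opposite sign. A walk is a sequence $W=(w_1,\dots,w_k)$, $k$ odd, with $w_i$ a vertex for odd $i$ and $w_i$ an edge joining $w_{i-1},w_{i+1}$ for even $i$; closed over $r$ if $w_1=w_k=r$; a trail has no repeated edge. $W$ is a diwalk if to each traversal of an edge $w_i$ one can assign signs to its end-occurrences equal to the signs of these vertices over $w_i$ (for a loop with one end $+$ and one end $-$, the two assigned signs are distinct), such that at every internal vertex term the signs assigned from the preceding and following edges are distinct. A ditrail is a diwalk that is a trail. For $k\ge3$ the sign of $w_1$ (resp. $w_k$) over $W$ is the sign assigned at $w_2$ (resp. $w_{k-1}$); $W$ is an $(\alpha,\beta)$-ditrail if these are $\alpha,\beta$; the trivial ditrail $(v)$ counts as both a $(+,-)$- and a $(-,+)$-ditrail. $G$ is an $\alpha$-radial with root $r$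 if every $v$ has an $(\alpha,-\alpha)$-ditrail from $v$ to $r$; it is almost strong if every $v\in V(G)\setminus\{r\}$ has a $(-\alpha,-\alpha)$-ditrail from $v$ to $r$, but $G$ has no $(-\alpha,-\alpha)$-ditrail closed over $r$. -}

module Defs where

open import Data.Nat using (ℕ; suc)
open import Data.Fin using (Fin; zero; suc)
open import Data.List using (List; []; _∷_; [_])
open import Data.List.Relation.Unary.Unique.Propositional using (Unique)
open import Data.Product using (Σ; _×_; _,_)
open import Data.Sum using (_⊎_)
open import Relation.Binary.PropositionalEquality using (_≡_; _≢_)
open import Relation.Nullary using (¬_)

data Sign : Set where
  plus minus : Sign

neg : Sign → Sign
neg plus  = minus
neg minus = plus

-- An edge of a bidirected graph on vertex set Fin n, given by its two
-- end-occurrences, each carrying the sign of that vertex over the edge.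
-- For a non-loop (u ≢ v) this is exactly the data ∂₊,∂₋ with
-- ∂₊ ∪ ∂₋ = {u,v}, ∂₊ ∩ ∂₋ = ∅.  For a loop (u ≡ v) the signs
-- (s,s) mean u ∈ ∂_s only, and (s, neg s) mean u ∈ ∂₊ ∩ ∂₋.
record Edge (n : ℕ) : Set where
  constructor mkEdge
  field
    end₁  : Fin n
    sign₁ : Sign
    end₂  : Fin n
    sign₂ : Sign
open Edge public

record BiGraph : Set where
  constructor mkBiGraph
  field
    nV   : ℕ
    nE   : ℕ
    edge : Fin nE → Edge nV
open BiGraph public

-- A traversal of edge E from vertex a to vertex b, with sign s assigned
-- at the occurrence of a and sign t assigned at the occurrence of b
-- (these are the signs of the ends over E; for a (+,-)-loop the two
-- assigned signs are distinct).
data Trav {n : ℕ} (E : Edge n) : Fin n → Sign → Sign → Fin n → Set where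
  fwd : Trav E (end₁ E) (sign₁ E) (sign₂ E) (end₂ E)
  bwd : Trav E (end₂ E) (sign₂ E) (sign₁ E) (end₁ E)

-- Nontrivial diwalks (k ≥ 3): DiWalk G a s t b es is a diwalk from a to b
-- with sign s of a over it, sign t of b over it, and edge sequence es.
data DiWalk (G : BiGraph) : Fin (nV G) → Sign → Sign → Fin (nV G)
            → List (Fin (nE G)) → Set where
  one  : ∀ {e a s t b} → Trav (edge G e) a s t b → DiWalk G a s t b [ e ]
  cons : ∀ {e a s t b s' t' c es} → Trav (edge G e) a s t b → t ≢ s'
       → DiWalk G b s' t' c es → DiWalk G a s t' c (e ∷ es)

-- (α,β)-ditrail from x to y.  The trivial ditrail (x) counts as an
-- (α, -α)-ditrail (i.e. both a (+,-)- and a (-,+)-ditrail).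
DiTrail : (G : BiGraph) → Sign → Sign → Fin (nV G) → Fin (nV G) → Set
DiTrail G α β x y =
  (x ≡ y × β ≡ neg α)
  ⊎ Σ (List (Fin (nE G))) (λ es → DiWalk G x α β y es × Unique es)

IsRadial : (G : BiGraph) → Sign → Fin (nV G) → Set
IsRadial G α r = ∀ v → DiTrail G α (neg α) v r

IsAlmostStrongRadial : (G : BiGraph) → Sign → Fin (nV G) → Set
IsAlmostStrongRadial G α r =
  IsRadial G α r
  × (∀ v → v ≢ r → DiTrail G (neg α) (neg α) v r)
  × ¬ DiTrail G (neg α) (neg α) r r

addEdge : (G : BiGraph) → Edge (nV G) → BiGraph
addEdge G E = mkBiGraph (nV G) (suc (nE G)) f
  where
  f : Fin (suc (nE G)) → Edge (nV G)
  f zero    = E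
  f (suc i) = edge G i

-- A (−α,−α)-ditrail closed over r in G + e would have to use e, since G has
-- none.  But e meets r with sign α: if the ditrail leaves r along e, the part
-- before e, and if it enters r along e, the part after e, is a (−α,−α)-ditrail
-- closed over r that avoids e, i.e. lies in G.  Ditrails of G survive in
-- G + e, so the radial and the (−α,−α)-reachability conditions carry over.
module Submission where

open import Defs
open import Data.Fin using (Fin; zero; suc)
open import Data.Fin.Properties using (suc-injective)
open import Data.List using (List; []; _∷_; [_]; map; _++_)
open import Data.List.Relation.Unary.All.Properties as All using ()
open import Data.List.Relation.Unary.AllPairs using ([]; _∷_)
open import Data.List.Relation.Unary.Unique.Propositional using (Unique)
open import Data.List.Relation.Unary.Unique.Propositional.Properties
  using (map⁺; map⁻)
open import Data.Product using (Σ-syntax; _×_; _,_)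
open import Data.Sum using (_⊎_; inj₁; inj₂)
open import Data.Empty using (⊥-elim)
open import Relation.Binary.PropositionalEquality
  using (_≡_; _≢_; refl; sym; subst; ≢-sym)
open import Relation.Nullary using (¬_)

≢neg : ∀ α → α ≢ neg α
≢neg plus  ()
≢neg minus ()

≢⇒≡neg : ∀ {α β} → α ≢ β → β ≡ neg α
≢⇒≡neg {plus}  {plus}  α≢β = ⊥-elim (α≢β refl)
≢⇒≡neg {plus}  {minus} _   = refl
≢⇒≡neg {minus} {plus}  _   = refl
≢⇒≡neg {minus} {minus} α≢β = ⊥-elim (α≢β refl)

Unique-++⁻ˡ : ∀ {A : Set} (xs : List A) {ys} → Unique (xs ++ ys) → Unique xs
Unique-++⁻ˡ []       _          = []
Unique-++⁻ˡ (x ∷ xs) (x∉ ∷ xs!) = All.++⁻ˡ xs x∉ ∷ Unique-++⁻ˡ xs xs!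

module _ (G : BiGraph) (E : Edge (nV G)) where

  lift-DiWalk : ∀ {a u t b es} → DiWalk G a u t b es
              → DiWalk (addEdge G E) a u t b (map suc es)
  lift-DiWalk (one tr)        = one tr
  lift-DiWalk (cons tr t≢s w) = cons tr t≢s (lift-DiWalk w)

  lift-DiTrail : ∀ {β γ v w} → DiTrail G β γ v w → DiTrail (addEdge G E) β γ v w
  lift-DiTrail (inj₁ trivial)         = inj₁ trivial
  lift-DiTrail (inj₂ (es , W , es!)) =
    inj₂ (map suc es , lift-DiWalk W , map⁺ suc-injective es!)

module _ (α : Sign) (G : BiGraph) (r x : Fin (nV G)) (s : Sign) where

  private
    G⁺ : BiGraph
    G⁺ = addEdge G (mkEdge x s r α)

  OldPrefix : Fin (nV G) → Sign → List (Fin (nE G⁺)) → Set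
  OldPrefix a u es = Σ[ es' ∈ List (Fin (nE G)) ] Σ[ rest ∈ List (Fin (nE G⁺)) ]
    (es ≡ map suc es' ++ rest × DiWalk G a u (neg α) r es')

  OldPrefix⇒DiTrail : ∀ {a u es} → Unique es → OldPrefix a u es → DiTrail G u (neg α) a r
  OldPrefix⇒DiTrail es! (es' , _ , refl , W) =
    inj₂ (es' , W , map⁻ (Unique-++⁻ˡ (map suc es') es!))

  -- The left disjunct says that the walk leaves r along the new edge.
  new-edge-first-or-OldPrefix : ¬ DiTrail G (neg α) (neg α) r r
    → ∀ {a u t b es} → DiWalk G⁺ a u t b es → Unique es → t ≡ neg α → b ≡ r
    → (a ≡ r × u ≡ α) ⊎ OldPrefix a u es
  new-edge-first-or-OldPrefix _ (one {e = zero} fwd) _ α≡negα _ = ⊥-elim (≢neg α α≡negα)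
  new-edge-first-or-OldPrefix _ (one {e = zero} bwd) _ _ _ = inj₁ (refl , refl)
  new-edge-first-or-OldPrefix _ (one {e = suc i} tr) _ refl refl =
    inj₂ ([ i ] , [] , refl , one tr)
  new-edge-first-or-OldPrefix _ (cons {e = zero} bwd _ _) _ _ _ = inj₁ (refl , refl)
  new-edge-first-or-OldPrefix noClosed (cons {e = zero} fwd α≢s' W) (_ ∷ es!) t≡ b≡
    with new-edge-first-or-OldPrefix noClosed W es! t≡ b≡
  ... | inj₁ (_ , s'≡α) = ⊥-elim (α≢s' (sym s'≡α))
  ... | inj₂ prefix     =
    ⊥-elim (noClosed (subst (λ s' → DiTrail G s' (neg α) r r) (≢⇒≡neg α≢s')
                            (OldPrefix⇒DiTrail es! prefix)))
  new-edge-first-or-OldPrefix noClosed (cons {e = suc i} tr t≢s' W) (_ ∷ es!) t≡ b≡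
    with new-edge-first-or-OldPrefix noClosed W es! t≡ b≡
  ... | inj₁ (refl , refl) =
    inj₂ ([ i ] , _ , refl , subst (λ t → DiWalk G _ _ t r [ i ]) (≢⇒≡neg (≢-sym t≢s')) (one tr))
  ... | inj₂ (es' , rest , refl , W') =
    inj₂ (i ∷ es' , rest , refl , cons tr t≢s' W')

  no-closed-DiTrail : ¬ DiTrail G (neg α) (neg α) r r → ¬ DiTrail G⁺ (neg α) (neg α) r r
  no-closed-DiTrail _ (inj₁ (_ , negα≡negnegα)) = ≢neg (neg α) negα≡negnegα
  no-closed-DiTrail noClosed (inj₂ (es , W , es!))
    with new-edge-first-or-OldPrefix noClosed W es! refl refl
  ... | inj₁ (_ , negα≡α) = ≢neg α (sym negα≡α)
  ... | inj₂ prefix       = noClosed (OldPrefix⇒DiTrail es! prefix)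

lemma10p11 : (α : Sign) (G : BiGraph) (r x : Fin (nV G)) (s : Sign)
    → IsAlmostStrongRadial G α r
    → IsAlmostStrongRadial (addEdge G (mkEdge x s r α)) α r
lemma10p11 α G r x s (radial , strong , noClosed) =
    (λ v → lift (radial v))
  , (λ v v≢r → lift (strong v v≢r))
  , no-closed-DiTrail α G r x s noClosed
  where
  lift : ∀ {β γ v} → DiTrail G β γ v r → DiTrail (addEdge G (mkEdge x s r α)) β γ v r
  lift = lift-DiTrail G (mkEdge x s r α)
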